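{- Let $V$ be a finite set of $n$ points with metric $d$, $D\subseteq V$, $k<|V|$, $\Delta=\max_{u,v\in V}d(u,v)$, and $\epsilon>0$. Let $r=\lceil 1+\log_{1+\epsilon}n\rceil$, $t_0=0$ and $t_i=(1+\epsilon)^{i-1}\Delta/n$ for $i=1,\dots,r$. Let $F^*\subseteq V$, $|F^*|=k$, be an optimal solution of the $k$-medians problem with optimal cost ${\sf OPT}=\sum_{v\in D}d(v,F^*)$, and for $i\ge1$ let $o_i$ be the number of points $u\in D$ with $t_{i-1}\le d(u,F^*)<t_i$. Then $\sum_{i=1}^r o_i t_i\le (1+\epsilon){\sf OPT}+\Delta$.
   Context: For $F\subseteq V$, $d(v,F)=\min_{f\in F}d(v,f)$. The $k$-medians problem asks for $F\subseteq V$ with $|F|=k$ minimizing $\sum_{v\in D}d(v,F)$.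
   Formalization: The metric d takes rational values instead of real ones, and the parameter ε is a positive rational. -}

module Defs where

open import Data.Nat as ℕ using (ℕ; zero; suc)
open import Data.Integer using (+_)
open import Data.Rational using (ℚ; 0ℚ; 1ℚ; _+_; _*_; _≤_; _<_; _⊔_; _⊓_; _/_)
open import Data.Rational.Properties using (_≤?_; _<?_)
open import Data.Fin using (Fin)
open import Data.Fin.Subset using (Subset; _∈_)
open import Data.Fin.Subset.Properties using (_∈?_)
open import Data.List using (List; []; _∷_; foldr; map; filter; length; allFin; upTo)
open import Data.Maybe using (Maybe; just; nothing)
open import Data.Product using (_×_)
open import Relation.Binary.PropositionalEquality using (_≡_)
open import Relation.Nullary using (¬_)
open import Relation.Nullary.Decidable using (_×-dec_)

ℕ→ℚ : ℕ → ℚ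
ℕ→ℚ m = + m / 1

_^ℚ_ : ℚ → ℕ → ℚ
q ^ℚ zero = 1ℚ
q ^ℚ suc m = q * (q ^ℚ m)

-- 1 / n  (only used for n ≥ 1; value 0 for n = 0 is irrelevant)
inv : ℕ → ℚ
inv zero = 0ℚ
inv (suc m) = + 1 / suc m

record IsMetric {n : ℕ} (d : Fin n → Fin n → ℚ) : Set where
  field
    nonneg    : ∀ x y → 0ℚ ≤ d x y
    zero-iff  : ∀ x y → d x y ≡ 0ℚ → x ≡ y
    refl-zero : ∀ x → d x x ≡ 0ℚ
    sym       : ∀ x y → d x y ≡ d y x
    triangle  : ∀ x y z → d x z ≤ d x y + d y z

elems : {n : ℕ} → Subset n → List (Fin n)
elems F = filter (_∈? F) (allFin _)

-- maximum of a list of rationals (0 for the empty list; all distances are ≥ 0)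
maxList : List ℚ → ℚ
maxList = foldr _⊔_ 0ℚ

minList : List ℚ → Maybe ℚ
minList [] = nothing
minList (x ∷ xs) with minList xs
... | nothing = just x
... | just m  = just (x ⊓ m)

diam : {n : ℕ} → (Fin n → Fin n → ℚ) → ℚ
diam {n} d = maxList (Data.List.concatMap (λ u → map (d u) (allFin n)) (allFin n))

-- d(v,F) = min_{f ∈ F} d(v,f)  (F is nonempty in all uses; 0 if F = ∅)
distSet : {n : ℕ} → (Fin n → Fin n → ℚ) → Fin n → Subset n → ℚ
distSet d v F with minList (map (d v) (elems F))
... | nothing = 0ℚ
... | just m  = m

sumℚ : List ℚ → ℚ
sumℚ = foldr _+_ 0ℚ

cost : {n : ℕ} → (Fin n → Fin n → ℚ) → Subset n → Subset n → ℚ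
cost d D F = sumℚ (map (λ v → distSet d v F) (elems D))

IsOptimal : {n : ℕ} → (Fin n → Fin n → ℚ) → Subset n → ℕ → Subset n → Set
IsOptimal d D k F = Data.Fin.Subset.∣ F ∣ ≡ k
  × (∀ (G : Subset _) → Data.Fin.Subset.∣ G ∣ ≡ k → cost d D F ≤ cost d D G)

-- r = ⌈1 + log_{1+ε} n⌉, characterised as the least natural number m
-- with m ≥ 1 + log_{1+ε} n, i.e. m ≥ 1 and (1+ε)^(m-1) ≥ n
IsCeilLog : ℚ → ℕ → ℕ → Set
IsCeilLog ε n r =
  (1 ℕ.≤ r × ℕ→ℚ n ≤ (1ℚ + ε) ^ℚ (r ℕ.∸ 1))
  × (∀ m → 1 ℕ.≤ m → ℕ→ℚ n ≤ (1ℚ + ε) ^ℚ (m ℕ.∸ 1) → r ℕ.≤ m)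

thr : ℚ → ℚ → ℕ → ℕ → ℚ
thr ε Δ n zero = 0ℚ
thr ε Δ n (suc j) = ((1ℚ + ε) ^ℚ j) * Δ * inv n

count : {n : ℕ} → (Fin n → Fin n → ℚ) → Subset n → Subset n → ℚ → ℚ → ℕ
count d D F lo hi =
  length (filter (λ u → (lo ≤? distSet d u F) ×-dec (distSet d u F <? hi)) (elems D))

levelSum : {n : ℕ} → (Fin n → Fin n → ℚ) → Subset n → Subset n → ℚ → ℕ → ℚ
levelSum {n} d D F ε r =
  sumℚ (map (λ j → ℕ→ℚ (count d D F (thr ε (diam d) n j) (thr ε (diam d) n (suc j)))
                    * thr ε (diam d) n (suc j))
            (upTo r))

-- A point u ∈ D at distance x = d(u, F*) lies in at most one band [t_{i-1}, t_i), and there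
-- its weight t_i is at most (1+ε)·x + t_1: for i ≥ 2 because t_i = (1+ε)·t_{i-1} ≤ (1+ε)·x,
-- and for i = 1 trivially.  Exchanging the order of summation, Σ o_i t_i is therefore at most
-- (1+ε)·OPT + |D|·Δ/n ≤ (1+ε)·OPT + Δ.  Neither the optimality of F* nor the value of r is
-- needed, and of the metric axioms only d ≥ 0 is used.

{-# OPTIONS --safe #-}
module Submission where

open import Defs
open import Data.Nat as ℕ using (ℕ; zero; suc)
open import Data.Rational using (ℚ; 0ℚ; 1ℚ; _+_; _*_; _≤_; _<_; mkℚ; *≤*; nonNegative)
open import Data.Fin using (Fin)
open import Data.Fin.Subset using (Subset)
open import Data.Fin.Subset.Properties using (_∈?_)

import Data.Nat.Properties as ℕ
import Data.Nat.Coprimality as Coprime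
import Data.Integer as ℤ
import Data.Integer.Properties as ℤ
open import Data.Rational.Properties
open import Data.Rational.Unnormalised.Base using (*≡*)
import Data.Rational.Unnormalised.Properties as ℚᵘ
open import Data.List using (List; []; _∷_; map; filter; length; upTo; allFin; concatMap)
import Data.List.Properties as List
open import Data.List.Relation.Unary.All as All using (All; []; _∷_)
import Data.List.Relation.Unary.All.Properties as All
import Data.Maybe.Relation.Unary.All as Maybe
open import Data.Product using (_×_; proj₁; proj₂)
open import Function using (_∘_; id)
open import Algebra.Bundles using (CommutativeMonoid)
open import Algebra.Properties.CommutativeSemigroup
  (CommutativeMonoid.commutativeSemigroup +-0-commutativeMonoid)
  using () renaming (interchange to +-interchange)
open import Relation.Nullary using (Dec; yes; no; ¬_)
open import Relation.Nullary.Decidable using (_×-dec_)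
open import Relation.Unary using (Decidable)
open import Relation.Binary.PropositionalEquality
  using (_≡_; refl; sym; trans; cong; cong₂; module ≡-Reasoning)

ℕ→ℚ≡mkℚ : ∀ m → ℕ→ℚ m ≡ mkℚ (ℤ.+ m) 0 (Coprime.sym (Coprime.1-coprimeTo m))
ℕ→ℚ≡mkℚ m = normalize-coprime _

-- Both sides have denominator 1, with numerators 1 + m and 1 + m * 1.
ℕ→ℚ-suc : ∀ m → ℕ→ℚ (suc m) ≡ 1ℚ + ℕ→ℚ m
ℕ→ℚ-suc m rewrite ℕ→ℚ≡mkℚ (suc m) | ℕ→ℚ≡mkℚ m = toℚᵘ-injective (ℚᵘ.≃-trans
  (*≡* (cong (λ z → (ℤ.+ 1 ℤ.+ z) ℤ.* ℤ.+ 1) (sym (ℤ.*-identityʳ (ℤ.+ m)))))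
  (ℚᵘ.≃-sym (toℚᵘ-homo-+ 1ℚ (mkℚ (ℤ.+ m) 0 (Coprime.sym (Coprime.1-coprimeTo m))))))

ℕ→ℚ-mono-≤ : ∀ {m n} → m ℕ.≤ n → ℕ→ℚ m ≤ ℕ→ℚ n
ℕ→ℚ-mono-≤ {m} {n} m≤n rewrite ℕ→ℚ≡mkℚ m | ℕ→ℚ≡mkℚ n =
  *≤* (ℤ.*-monoʳ-≤-nonNeg (ℤ.+ 1) (ℤ.+≤+ m≤n))

ℕ→ℚ*inv : ∀ m → ℕ→ℚ (suc m) * inv (suc m) ≡ 1ℚ
ℕ→ℚ*inv m rewrite ℕ→ℚ≡mkℚ (suc m) | normalize-coprime {1} {m} (Coprime.1-coprimeTo (suc m)) =
  *-inverseʳ (mkℚ (ℤ.+ suc m) 0 (Coprime.sym (Coprime.1-coprimeTo (suc m))))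

inv-nonNeg : ∀ m → 0ℚ ≤ inv m
inv-nonNeg zero    = ≤-refl
inv-nonNeg (suc m) = nonNegative⁻¹ (inv (suc m)) {{normalize-nonNeg 1 (suc m)}}

<⇒≱ : ∀ {p q} → p < q → ¬ q ≤ p
<⇒≱ p<q q≤p = <-irrefl refl (<-≤-trans p<q q≤p)

*-nonNeg : ∀ {p q} → 0ℚ ≤ p → 0ℚ ≤ q → 0ℚ ≤ p * q
*-nonNeg {p} 0≤p 0≤q =
  ≤-trans (≤-reflexive (sym (*-zeroʳ p))) (*-monoˡ-≤-nonNeg p {{nonNegative 0≤p}} 0≤q)

p≤p+q : ∀ {p q} → 0ℚ ≤ q → p ≤ p + q
p≤p+q {p} 0≤q = ≤-trans (≤-reflexive (sym (+-identityʳ p))) (+-monoʳ-≤ p 0≤q)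

p≤q+p : ∀ {p q} → 0ℚ ≤ q → p ≤ q + p
p≤q+p {p} 0≤q = ≤-trans (≤-reflexive (sym (+-identityˡ p))) (+-monoˡ-≤ p 0≤q)

^ℚ-nonNeg : ∀ {q} → 0ℚ ≤ q → ∀ j → 0ℚ ≤ q ^ℚ j
^ℚ-nonNeg 0≤q zero    = nonNegative⁻¹ 1ℚ
^ℚ-nonNeg 0≤q (suc j) = *-nonNeg 0≤q (^ℚ-nonNeg 0≤q j)

maxList-nonNeg : ∀ xs → 0ℚ ≤ maxList xs
maxList-nonNeg []       = ≤-refl
maxList-nonNeg (x ∷ xs) = p≤q⇒p≤r⊔q x (maxList-nonNeg xs)

minList-nonNeg : ∀ {xs} → All (0ℚ ≤_) xs → Maybe.All (0ℚ ≤_) (minList xs)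
minList-nonNeg [] = Maybe.nothing
minList-nonNeg {x ∷ xs} (0≤x ∷ 0≤xs) with minList xs | minList-nonNeg 0≤xs
... | _ | Maybe.nothing     = Maybe.just 0≤x
... | _ | Maybe.just 0≤min = Maybe.just (⊓-glb 0≤x 0≤min)

distSet-nonNeg : ∀ {n} {d : Fin n → Fin n → ℚ} → (∀ u v → 0ℚ ≤ d u v) →
                 ∀ v F → 0ℚ ≤ distSet d v F
distSet-nonNeg {d = d} 0≤d v F
  with minList (map (d v) (elems F))
     | minList-nonNeg (All.map⁺ (All.universal (0≤d v) (elems F)))
... | _ | Maybe.nothing   = ≤-refl
... | _ | Maybe.just 0≤dv = 0≤dv

private variable
  A B : Set

sumℚ-map-+ : ∀ (f g : A → ℚ) xs →
             sumℚ (map (λ x → f x + g x) xs) ≡ sumℚ (map f xs) + sumℚ (map g xs)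
sumℚ-map-+ f g []       = sym (+-identityʳ 0ℚ)
sumℚ-map-+ f g (x ∷ xs) = begin
  (f x + g x) + sumℚ (map (λ x → f x + g x) xs)  ≡⟨ cong ((f x + g x) +_) (sumℚ-map-+ f g xs) ⟩
  (f x + g x) + (F + G)                          ≡⟨ +-interchange (f x) (g x) F G ⟩
  (f x + F) + (g x + G)                          ∎
  where
  open ≡-Reasoning
  F = sumℚ (map f xs)
  G = sumℚ (map g xs)

sumℚ-map-*ˡ : ∀ c (f : A → ℚ) xs → sumℚ (map (λ x → c * f x) xs) ≡ c * sumℚ (map f xs)
sumℚ-map-*ˡ c f []       = sym (*-zeroʳ c)
sumℚ-map-*ˡ c f (x ∷ xs) =
  trans (cong (c * f x +_) (sumℚ-map-*ˡ c f xs)) (sym (*-distribˡ-+ c (f x) _))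

sumℚ-map-const : ∀ c (xs : List A) → sumℚ (map (λ _ → c) xs) ≡ ℕ→ℚ (length xs) * c
sumℚ-map-const c []       = sym (*-zeroˡ c)
sumℚ-map-const c (x ∷ xs) = begin
  c + sumℚ (map (λ _ → c) xs)        ≡⟨ cong₂ _+_ (sym (*-identityˡ c)) (sumℚ-map-const c xs) ⟩
  1ℚ * c + ℕ→ℚ (length xs) * c       ≡⟨ sym (*-distribʳ-+ c 1ℚ (ℕ→ℚ (length xs))) ⟩
  (1ℚ + ℕ→ℚ (length xs)) * c         ≡⟨ cong (_* c) (sym (ℕ→ℚ-suc (length xs))) ⟩
  ℕ→ℚ (suc (length xs)) * c          ∎
  where open ≡-Reasoning

sumℚ-map-mono-≤ : ∀ {f g : A → ℚ} → (∀ x → f x ≤ g x) →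
                  ∀ xs → sumℚ (map f xs) ≤ sumℚ (map g xs)
sumℚ-map-mono-≤ f≤g []       = ≤-refl
sumℚ-map-mono-≤ f≤g (x ∷ xs) = +-mono-≤ (f≤g x) (sumℚ-map-mono-≤ f≤g xs)

sumℚ-map-swap : ∀ (f : A → B → ℚ) xs ys →
                sumℚ (map (λ x → sumℚ (map (f x) ys)) xs)
                ≡ sumℚ (map (λ y → sumℚ (map (λ x → f x y) xs)) ys)
sumℚ-map-swap f [] ys = begin
  0ℚ                               ≡⟨ sym (*-zeroʳ (ℕ→ℚ (length ys))) ⟩
  ℕ→ℚ (length ys) * 0ℚ             ≡⟨ sym (sumℚ-map-const 0ℚ ys) ⟩
  sumℚ (map (λ _ → 0ℚ) ys)         ∎
  where open ≡-Reasoning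
sumℚ-map-swap f (x ∷ xs) ys =
  trans (cong (sumℚ (map (f x) ys) +_) (sumℚ-map-swap f xs ys))
        (sym (sumℚ-map-+ (f x) (λ y → sumℚ (map (λ x → f x y) xs)) ys))

sumℚ-map-upTo-suc : ∀ (f : ℕ → ℚ) r →
                    sumℚ (map f (upTo (suc r))) ≡ f 0 + sumℚ (map (f ∘ suc) (upTo r))
sumℚ-map-upTo-suc f r =
  cong (λ s → f 0 + sumℚ s) (trans (List.map-applyUpTo suc f r) (sym (List.map-upTo (f ∘ suc) r)))

𝟙 : ∀ {P : Set} → Dec P → ℚ
𝟙 (yes _) = 1ℚ
𝟙 (no _)  = 0ℚ

𝟙-reject-* : ∀ {P : Set} (P? : Dec P) w → ¬ P → 𝟙 P? * w ≡ 0ℚ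
𝟙-reject-* (yes p) w ¬p with () ← ¬p p
𝟙-reject-* (no _)  w ¬p = *-zeroˡ w

𝟙-*-≤ : ∀ {P : Set} (P? : Dec P) {w B} → (P → w ≤ B) → 0ℚ ≤ B → 𝟙 P? * w ≤ B
𝟙-*-≤ (yes p) {w} w≤B 0≤B = ≤-trans (≤-reflexive (*-identityˡ w)) (w≤B p)
𝟙-*-≤ (no _)  {w} w≤B 0≤B = ≤-trans (≤-reflexive (*-zeroˡ w)) 0≤B

length-filter-* : ∀ {P : A → Set} (P? : Decidable P) c xs →
                  ℕ→ℚ (length (filter P? xs)) * c ≡ sumℚ (map (λ x → 𝟙 (P? x) * c) xs)
length-filter-* P? c []       = *-zeroˡ c
length-filter-* P? c (x ∷ xs) with P? x
... | no _  = begin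
  ℕ→ℚ (length (filter P? xs)) * c  ≡⟨ length-filter-* P? c xs ⟩
  S                                ≡⟨ sym (+-identityˡ S) ⟩
  0ℚ + S                           ≡⟨ cong (_+ S) (sym (*-zeroˡ c)) ⟩
  0ℚ * c + S                       ∎
  where
  open ≡-Reasoning
  S = sumℚ (map (λ x → 𝟙 (P? x) * c) xs)
... | yes _ = begin
  ℕ→ℚ (suc m) * c                              ≡⟨ cong (_* c) (ℕ→ℚ-suc m) ⟩
  (1ℚ + ℕ→ℚ m) * c                             ≡⟨ *-distribʳ-+ c 1ℚ (ℕ→ℚ m) ⟩
  1ℚ * c + ℕ→ℚ m * c                           ≡⟨ cong (1ℚ * c +_) (length-filter-* P? c xs) ⟩
  1ℚ * c + sumℚ (map (λ x → 𝟙 (P? x) * c) xs)  ∎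
  where
  open ≡-Reasoning
  m = length (filter P? xs)

Monotone : (ℕ → ℚ) → Set
Monotone t = ∀ j → t j ≤ t (suc j)

band? : (t : ℕ → ℚ) (x : ℚ) (j : ℕ) → Dec (t j ≤ x × x < t (suc j))
band? t x j = (t j ≤? x) ×-dec (x <? t (suc j))

bandSum : (t w : ℕ → ℚ) → ℚ → ℕ → ℚ
bandSum t w x r = sumℚ (map (λ j → 𝟙 (band? t x j) * w j) (upTo r))

bandSum-suc : ∀ t w x r →
              bandSum t w x (suc r) ≡ 𝟙 (band? t x 0) * w 0 + bandSum (t ∘ suc) (w ∘ suc) x r
bandSum-suc t w x = sumℚ-map-upTo-suc (λ j → 𝟙 (band? t x j) * w j)

bandSum-below : ∀ {t} w {x} → Monotone t → x < t 0 → ∀ r → bandSum t w x r ≡ 0ℚ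
bandSum-below w mono x<t₀ zero    = refl
bandSum-below {t} w {x} mono x<t₀ (suc r) = begin
  bandSum t w x (suc r)
    ≡⟨ bandSum-suc t w x r ⟩
  𝟙 (band? t x 0) * w 0 + bandSum (t ∘ suc) (w ∘ suc) x r
    ≡⟨ cong₂ _+_ (𝟙-reject-* (band? t x 0) (w 0) (<⇒≱ x<t₀ ∘ proj₁))
                 (bandSum-below (w ∘ suc) (mono ∘ suc) (<-≤-trans x<t₀ (mono 0)) r) ⟩
  0ℚ + 0ℚ
    ≡⟨ +-identityʳ 0ℚ ⟩
  0ℚ
    ∎
  where open ≡-Reasoning

-- The bands [t j, t (suc j)) of a monotone t are disjoint, so at most one term is nonzero.
bandSum-≤ : ∀ {t w x B} → Monotone t → 0ℚ ≤ B → (∀ j → t j ≤ x → w j ≤ B) →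
            ∀ r → bandSum t w x r ≤ B
bandSum-≤ mono 0≤B w≤B zero = 0≤B
bandSum-≤ {t} {w} {x} {B} mono 0≤B w≤B (suc r) = by-cases (x <? t 1)
  where
  open ≤-Reasoning
  first rest : ℚ
  first = 𝟙 (band? t x 0) * w 0
  rest  = bandSum (t ∘ suc) (w ∘ suc) x r

  by-cases : Dec (x < t 1) → bandSum t w x (suc r) ≤ B
  by-cases (yes x<t₁) = begin
    bandSum t w x (suc r)  ≡⟨ bandSum-suc t w x r ⟩
    first + rest           ≡⟨ cong (first +_) (bandSum-below (w ∘ suc) (mono ∘ suc) x<t₁ r) ⟩
    first + 0ℚ             ≡⟨ +-identityʳ first ⟩
    first                  ≤⟨ 𝟙-*-≤ (band? t x 0) (w≤B 0 ∘ proj₁) 0≤B ⟩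
    B                      ∎
  by-cases (no x≮t₁) = begin
    bandSum t w x (suc r)  ≡⟨ bandSum-suc t w x r ⟩
    first + rest           ≡⟨ cong (_+ rest) (𝟙-reject-* (band? t x 0) (w 0) (x≮t₁ ∘ proj₂)) ⟩
    0ℚ + rest              ≡⟨ +-identityˡ rest ⟩
    rest                   ≤⟨ bandSum-≤ (mono ∘ suc) 0≤B (w≤B ∘ suc) r ⟩
    B                      ∎

sumℚ-bandCounts : ∀ (t w : ℕ → ℚ) (x : A → ℚ) r xs →
  sumℚ (map (λ j → ℕ→ℚ (length (filter (λ u → band? t (x u) j) xs)) * w j) (upTo r))
  ≡ sumℚ (map (λ u → bandSum t w (x u) r) xs)
sumℚ-bandCounts t w x r xs = begin
  sumℚ (map (λ j → ℕ→ℚ (length (filter (λ u → band? t (x u) j) xs)) * w j) (upTo r))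
    ≡⟨ cong sumℚ (List.map-cong (λ j → length-filter-* (λ u → band? t (x u) j) (w j) xs) (upTo r)) ⟩
  sumℚ (map (λ j → sumℚ (map (λ u → 𝟙 (band? t (x u) j) * w j) xs)) (upTo r))
    ≡⟨ sumℚ-map-swap (λ j u → 𝟙 (band? t (x u) j) * w j) (upTo r) xs ⟩
  sumℚ (map (λ u → bandSum t w (x u) r) xs)
    ∎
  where open ≡-Reasoning

sumℚ-map-affine : ∀ a (f : A → ℚ) b xs →
                  sumℚ (map (λ x → a * f x + b) xs) ≡ a * sumℚ (map f xs) + ℕ→ℚ (length xs) * b
sumℚ-map-affine a f b xs = begin
  sumℚ (map (λ x → a * f x + b) xs)
    ≡⟨ sumℚ-map-+ (λ x → a * f x) (λ _ → b) xs ⟩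
  sumℚ (map (λ x → a * f x) xs) + sumℚ (map (λ _ → b) xs)
    ≡⟨ cong₂ _+_ (sumℚ-map-*ˡ a f xs) (sumℚ-map-const b xs) ⟩
  a * sumℚ (map f xs) + ℕ→ℚ (length xs) * b
    ∎
  where open ≡-Reasoning

length-elems : ∀ {n} (F : Subset n) → length (elems F) ℕ.≤ n
length-elems {n} F =
  ℕ.≤-trans (List.length-filter (_∈? F) (allFin n)) (ℕ.≤-reflexive (List.length-tabulate id))

diam-nonNeg : ∀ {n} (d : Fin n → Fin n → ℚ) → 0ℚ ≤ diam d
diam-nonNeg {n} d = maxList-nonNeg (concatMap (λ u → map (d u) (allFin n)) (allFin n))

thr-suc-suc : ∀ ε Δ n j → thr ε Δ n (suc (suc j)) ≡ (1ℚ + ε) * thr ε Δ n (suc j)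
thr-suc-suc ε Δ n j =
  trans (cong (_* inv n) (*-assoc (1ℚ + ε) ((1ℚ + ε) ^ℚ j) Δ)) (*-assoc (1ℚ + ε) _ (inv n))

ℕ→ℚ*thr₁ : ∀ ε Δ {n} → 0 ℕ.< n → ℕ→ℚ n * thr ε Δ n 1 ≡ Δ
ℕ→ℚ*thr₁ ε Δ {suc m} _ = begin
  n * ((1ℚ * Δ) * i)   ≡⟨ cong (λ z → n * (z * i)) (*-identityˡ Δ) ⟩
  n * (Δ * i)          ≡⟨ cong (n *_) (*-comm Δ i) ⟩
  n * (i * Δ)          ≡⟨ sym (*-assoc n i Δ) ⟩
  (n * i) * Δ          ≡⟨ cong (_* Δ) (ℕ→ℚ*inv m) ⟩
  1ℚ * Δ               ≡⟨ *-identityˡ Δ ⟩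
  Δ                    ∎
  where
  open ≡-Reasoning
  n = ℕ→ℚ (suc m)
  i = inv (suc m)

module Thresholds {ε Δ : ℚ} (0≤ε : 0ℚ ≤ ε) (0≤Δ : 0ℚ ≤ Δ) (n : ℕ) where

  1≤1+ε : 1ℚ ≤ 1ℚ + ε
  1≤1+ε = p≤p+q 0≤ε

  0≤1+ε : 0ℚ ≤ 1ℚ + ε
  0≤1+ε = ≤-trans (nonNegative⁻¹ 1ℚ) 1≤1+ε

  thr-nonNeg : ∀ j → 0ℚ ≤ thr ε Δ n j
  thr-nonNeg zero    = ≤-refl
  thr-nonNeg (suc j) = *-nonNeg (*-nonNeg (^ℚ-nonNeg 0≤1+ε j) 0≤Δ) (inv-nonNeg n)

  thr-monotone : Monotone (thr ε Δ n)
  thr-monotone zero    = thr-nonNeg 1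
  thr-monotone (suc j) = begin
    thr ε Δ n (suc j)              ≡⟨ sym (*-identityˡ _) ⟩
    1ℚ * thr ε Δ n (suc j)         ≤⟨ *-monoʳ-≤-nonNeg _ {{nonNegative (thr-nonNeg (suc j))}} 1≤1+ε ⟩
    (1ℚ + ε) * thr ε Δ n (suc j)   ≡⟨ sym (thr-suc-suc ε Δ n j) ⟩
    thr ε Δ n (suc (suc j))        ∎
    where open ≤-Reasoning

  thr-suc-≤ : ∀ {x} → 0ℚ ≤ x → ∀ j → thr ε Δ n j ≤ x →
              thr ε Δ n (suc j) ≤ (1ℚ + ε) * x + thr ε Δ n 1
  thr-suc-≤ 0≤x zero    _    = p≤q+p (*-nonNeg 0≤1+ε 0≤x)
  thr-suc-≤ {x} 0≤x (suc j) tⱼ≤x = begin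
    thr ε Δ n (suc (suc j))        ≡⟨ thr-suc-suc ε Δ n j ⟩
    (1ℚ + ε) * thr ε Δ n (suc j)   ≤⟨ *-monoˡ-≤-nonNeg (1ℚ + ε) {{nonNegative 0≤1+ε}} tⱼ≤x ⟩
    (1ℚ + ε) * x                   ≤⟨ p≤p+q (thr-nonNeg 1) ⟩
    (1ℚ + ε) * x + thr ε Δ n 1     ∎
    where open ≤-Reasoning

  ℕ→ℚ*thr₁-≤ : ∀ {c} → 0 ℕ.< n → c ℕ.≤ n → ℕ→ℚ c * thr ε Δ n 1 ≤ Δ
  ℕ→ℚ*thr₁-≤ 0<n c≤n =
    ≤-trans (*-monoʳ-≤-nonNeg (thr ε Δ n 1) {{nonNegative (thr-nonNeg 1)}} (ℕ→ℚ-mono-≤ c≤n))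
            (≤-reflexive (ℕ→ℚ*thr₁ ε Δ 0<n))

lemma4p3 : (n : ℕ) (d : Fin n → Fin n → ℚ) → IsMetric d →
    (D : Subset n) (k : ℕ) → 1 ℕ.≤ k → k ℕ.< n →
    (ε : ℚ) → 0ℚ < ε →
    (r : ℕ) → IsCeilLog ε n r →
    (Fstar : Subset n) → IsOptimal d D k Fstar →
    levelSum d D Fstar ε r ≤ (1ℚ + ε) * cost d D Fstar + diam d
lemma4p3 n d isMetric D k 1≤k k<n ε 0<ε r _ F _ = begin
  levelSum d D F ε r
    ≡⟨ sumℚ-bandCounts t (t ∘ suc) x r (elems D) ⟩
  sumℚ (map (λ u → bandSum t (t ∘ suc) (x u) r) (elems D))
    ≤⟨ sumℚ-map-mono-≤ (λ u → bandSum-≤ thr-monotone (0≤B u) (thr-suc-≤ (0≤x u)) r) (elems D) ⟩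
  sumℚ (map (λ u → (1ℚ + ε) * x u + t 1) (elems D))
    ≡⟨ sumℚ-map-affine (1ℚ + ε) x (t 1) (elems D) ⟩
  (1ℚ + ε) * cost d D F + ℕ→ℚ (length (elems D)) * t 1
    ≤⟨ +-monoʳ-≤ ((1ℚ + ε) * cost d D F) (ℕ→ℚ*thr₁-≤ (ℕ.<-trans 1≤k k<n) (length-elems D)) ⟩
  (1ℚ + ε) * cost d D F + diam d
    ∎
  where
  open ≤-Reasoning
  open Thresholds (<⇒≤ 0<ε) (diam-nonNeg d) n
  t : ℕ → ℚ
  t = thr ε (diam d) n
  x : Fin n → ℚ
  x u = distSet d u F
  0≤x : ∀ u → 0ℚ ≤ x u
  0≤x u = distSet-nonNeg (IsMetric.nonneg isMetric) u F
  0≤B : ∀ u → 0ℚ ≤ (1ℚ + ε) * x u + t 1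
  0≤B u = ≤-trans (thr-nonNeg 1) (p≤q+p (*-nonNeg 0≤1+ε (0≤x u)))
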